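{- Let $G$ be a bipartite graph with bipartition $(U,W)$, $U=\{u_1,\ldots,u_n\}$, $W=\{w_1,\ldots,w_n\}$, with perfect matching $M=\{u_iw_i:1\le i\le n\}$. Let $G_1$ be a subgraph of $G$ such that $M_1=E(G_1)\cap M$ is a perfect matching of $G_1$. Let $D=D(G,M)$ and let $D_1=D(G_1,M_1)$, viewed as a subdigraph of $D$. Then the following are equivalent: (1) $G_1$ is an elementary component of $G$, or $G_1$ consists of a single fixed double edge of $G$ (with its two end-vertices); (2) $D_1$ is a strong component of $D$.
   Context: Graphs and digraphs are finite, without loops and multiple edges/arcs. $D(G,M)$ is the digraph with vertex set $\{v_1,\ldots,v_n\}$ ($v_i$ corresponding to the edge $u_iw_i\in M$) having an arc from $v_i$ to $v_j$ if and only if $i\ne j$ and $u_iw_j\in E(G)$. $D(G_1,M_1)$ is defined in the same way from $G_1$ and $M_1$: its vertices are the $v_i$ with $u_iw_i\in M_1$, and it has an arc from $v_i$ to $v_j$ iff $i\neq j$ and $u_iw_j\in E(G_1)$; thus it is a subdigraph of $D$. A digraph is strong if for any two distinct vertices $x,y$ there are directed paths from $x$ to $y$ and from $y$ to $x$ (a one-vertex digraph is strong); a strong component of $D$ is a maximal strong subdigraph of $D$. An edge of $G$ is fixed single if it lies in no perfect matching of $G$, fixed double if it lies in every perfect matching of $G$, and fixed if it is either. The non-fixed edges of $G$ (with their end-vertices) form a subgraph $H$; the connected components of $H$ are the elementary components of $G$. -}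

module Defs where

open import Data.Nat using (ℕ)
open import Data.Fin using (Fin; _≟_)
open import Data.Bool using (Bool; true; false; _∧_; not; if_then_else_)
open import Data.Sum using (_⊎_; inj₁; inj₂)
open import Data.Product using (Σ; ∃; _×_; _,_)
open import Data.Empty using (⊥)
open import Relation.Nullary using (¬_; does)
open import Relation.Binary.PropositionalEquality using (_≡_)
open import Relation.Binary.Construct.Closure.ReflexiveTransitive using (Star)

-- Vertices of a bipartite graph with parts U = {u_0..u_{n-1}}, W = {w_0..w_{n-1}}:
-- inj₁ i stands for u_i, inj₂ j stands for w_j.
Vtx : ℕ → Set
Vtx n = Fin n ⊎ Fin n

-- A bipartite graph G on U ∪ W (all 2n vertices): G i j ≡ true iff u_i w_j ∈ E(G).
BGraph : ℕ → Set
BGraph n = Fin n → Fin n → Bool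

record Subgraph (n : ℕ) : Set where
  field
    vert : Vtx n → Bool
    edge : Fin n → Fin n → Bool
open Subgraph public

record GraphP (n : ℕ) : Set₁ where
  field
    pvert : Vtx n → Set
    pedge : Fin n → Fin n → Set
open GraphP public

full : ∀ {n} → BGraph n → Subgraph n
full G = record { vert = λ _ → true ; edge = G }

toP : ∀ {n} → Subgraph n → GraphP n
toP K = record { pvert = λ x → vert K x ≡ true ; pedge = λ i j → edge K i j ≡ true }

-- K is a subgraph of L (K is a graph: its edges have their ends in its vertex set).
_⊑_ : ∀ {n} → Subgraph n → GraphP n → Set
_⊑_ {n} K L =
  (∀ (x : Vtx n) → vert K x ≡ true → pvert L x) ×
  (∀ (i j : Fin n) → edge K i j ≡ true →
     pedge L i j × vert K (inj₁ i) ≡ true × vert K (inj₂ j) ≡ true)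

_≤G_ : ∀ {n} → Subgraph n → Subgraph n → Set
_≤G_ {n} K L =
  (∀ (x : Vtx n) → vert K x ≡ true → vert L x ≡ true) ×
  (∀ (i j : Fin n) → edge K i j ≡ true → edge L i j ≡ true)

ExactlyOne : ∀ {n} → (Fin n → Set) → Set
ExactlyOne {n} P = Σ (Fin n) λ j → P j × (∀ k → P k → k ≡ j)

IsPM : ∀ {n} → Subgraph n → (Fin n → Fin n → Bool) → Set
IsPM {n} K N =
  (∀ (i j : Fin n) → N i j ≡ true → edge K i j ≡ true) ×
  (∀ (i : Fin n) → vert K (inj₁ i) ≡ true → ExactlyOne (λ j → N i j ≡ true)) ×
  (∀ (j : Fin n) → vert K (inj₂ j) ≡ true → ExactlyOne (λ i → N i j ≡ true))

Mmatch : ∀ n → Fin n → Fin n → Bool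
Mmatch n i j = does (i ≟ j)

M∩ : ∀ {n} → Subgraph n → Fin n → Fin n → Bool
M∩ K i j = if does (i ≟ j) then edge K i j else false

FixedSingle : ∀ {n} → BGraph n → Fin n → Fin n → Set
FixedSingle {n} G i j =
  G i j ≡ true × (∀ (N : Fin n → Fin n → Bool) → IsPM (full G) N → N i j ≡ false)

FixedDouble : ∀ {n} → BGraph n → Fin n → Fin n → Set
FixedDouble {n} G i j =
  G i j ≡ true × (∀ (N : Fin n → Fin n → Bool) → IsPM (full G) N → N i j ≡ true)

Fixed : ∀ {n} → BGraph n → Fin n → Fin n → Set
Fixed G i j = FixedSingle G i j ⊎ FixedDouble G i j

NonFixed : ∀ {n} → BGraph n → Fin n → Fin n → Set
NonFixed G i j = G i j ≡ true × ¬ Fixed G i j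

Hgraph : ∀ {n} → BGraph n → GraphP n
Hgraph G = record { pvert = pv ; pedge = NonFixed G }
  where
    pv : Vtx _ → Set
    pv (inj₁ i) = ∃ λ j → NonFixed G i j
    pv (inj₂ j) = ∃ λ i → NonFixed G i j

Adj : ∀ {n} → Subgraph n → Vtx n → Vtx n → Set
Adj K (inj₁ i) (inj₂ j) = edge K i j ≡ true
Adj K (inj₂ j) (inj₁ i) = edge K i j ≡ true
Adj K (inj₁ _) (inj₁ _) = ⊥
Adj K (inj₂ _) (inj₂ _) = ⊥

Connected : ∀ {n} → Subgraph n → Set
Connected {n} K =
  (∃ λ (x : Vtx n) → vert K x ≡ true) ×
  (∀ (x y : Vtx n) → vert K x ≡ true → vert K y ≡ true → Star (Adj K) x y)

IsConnectedComponent : ∀ {n} → GraphP n → Subgraph n → Set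
IsConnectedComponent {n} L K =
  K ⊑ L × Connected K ×
  (∀ (K' : Subgraph n) → K' ⊑ L → Connected K' → K ≤G K' → K' ≤G K)

IsElementaryComponent : ∀ {n} → BGraph n → Subgraph n → Set
IsElementaryComponent G K = IsConnectedComponent (Hgraph G) K

IsSingleFixedDoubleEdge : ∀ {n} → BGraph n → Subgraph n → Set
IsSingleFixedDoubleEdge {n} G K = Σ (Fin n) λ i → Σ (Fin n) λ j →
  FixedDouble G i j ×
  (∀ (x : Vtx n) → (vert K x ≡ true → (x ≡ inj₁ i ⊎ x ≡ inj₂ j)) ×
                    ((x ≡ inj₁ i ⊎ x ≡ inj₂ j) → vert K x ≡ true)) ×
  (∀ (a b : Fin n) → (edge K a b ≡ true → (a ≡ i × b ≡ j)) ×
                     ((a ≡ i × b ≡ j) → edge K a b ≡ true))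

record Subdigraph (n : ℕ) : Set where
  field
    dvert : Fin n → Bool
    darc  : Fin n → Fin n → Bool
open Subdigraph public

-- D(K, E(K) ∩ M): vertex v_i iff u_i w_i ∈ E(K); arc v_i → v_j iff i ≠ j and u_i w_j ∈ E(K).
Dig : ∀ {n} → Subgraph n → Subdigraph n
Dig K = record
  { dvert = λ i → edge K i i
  ; darc  = λ i j → edge K i i ∧ edge K j j ∧ not (does (i ≟ j)) ∧ edge K i j }

_≼_ : ∀ {n} → Subdigraph n → Subdigraph n → Set
_≼_ {n} K L =
  (∀ (i : Fin n) → dvert K i ≡ true → dvert L i ≡ true) ×
  (∀ (i j : Fin n) → darc K i j ≡ true →
     darc L i j ≡ true × dvert K i ≡ true × dvert K j ≡ true)

Strong : ∀ {n} → Subdigraph n → Set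
Strong {n} K =
  (∃ λ (i : Fin n) → dvert K i ≡ true) ×
  (∀ (x y : Fin n) → dvert K x ≡ true → dvert K y ≡ true →
     Star (λ a b → darc K a b ≡ true) x y)

IsStrongComponent : ∀ {n} → Subdigraph n → Subdigraph n → Set
IsStrongComponent {n} L K =
  K ≼ L × Strong K × (∀ (K' : Subdigraph n) → K' ≼ L → Strong K' → K ≼ K' → K' ≼ K)

-- Write a → b (a ≠ b) for the arc v_a v_b of D = D(G,M), i.e. the edge u_a w_b of G.
-- The proof rests on two dual facts about a relation T on Fin n:
--   * (orbits) if σ is an injection of Fin n each of whose moves x ↦ σ x is a T-step,
--     then σ x reaches x back by T-steps;
--   * (cyclic shifts) a T-step i → j followed by a T-walk from j back to i yields such an
--     injection with σ i = j, obtained by shifting along a simple cycle.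
-- Perfect matchings of G are exactly the injections σ with u_a w_{σ a} ∈ E(G) for all a,
-- so these facts say: an edge u_b w_c with b ≠ c is non-fixed iff b and c lie in the same
-- strong class of D, and u_a w_a is non-fixed iff v_a lies on a cycle of D (otherwise it is
-- fixed double).  Consequently, for every a the subgraph of G induced by the strong class of
-- v_a is an elementary component (if v_a lies on a cycle) or a single fixed double edge
-- (if not), and its digraph is a strong component of D.  Theorem 2.1 follows once we show
-- that each of the two conditions on G₁ forces G₁ to be such a class subgraph.

module Submission where

open import Defs
open import Data.Sum using (_⊎_)
open import Function.Bundles using (_⇔_)

open import Function.Bundles using (mk⇔; Equivalence)
open import Function.Definitions using (Injective)
open import Data.Nat using (ℕ; zero; suc; _+_; _≤_; s≤s)
open import Data.Nat.Properties using (n<1+n; <-irrefl; m≤n⇒∃[o]m+o≡n; +-suc; m≤n⇒m≤1+n)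
open import Data.Fin using (Fin; zero; suc; toℕ; punchOut; _≟_)
open import Data.Fin.Properties using (any?; pigeonhole; punchOut-injective; injective⇒≤)
open import Data.Sum using (inj₁; inj₂; [_,_])
open import Data.Product using (∃; _×_; _,_; proj₁; proj₂)
open import Data.Empty using (⊥-elim)
open import Data.Bool using (Bool; true; false; _∧_; not; if_then_else_)
import Data.Bool.Properties as Bool
open import Data.Maybe using (Maybe; just; nothing; fromMaybe)
open import Data.Maybe.Properties using (just-injective)
open import Data.List using (List; []; _∷_; length; lookup)
open import Data.List.Relation.Unary.All as All using (All; []; _∷_)
open import Data.List.Relation.Unary.Any using (here; there)
open import Data.List.Relation.Unary.Unique.Propositional using (Unique; []; _∷_)
open import Data.List.Membership.Propositional using (_∈_)
open import Data.List.Membership.DecPropositional using () renaming (_∈?_ to member?)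
open import Relation.Nullary using (¬_; Dec; yes; no; does)
open import Relation.Nullary.Decidable using (_×-dec_; ¬?; dec-true; dec-false)
open import Relation.Binary.PropositionalEquality hiding ([_])
open import Relation.Binary.Construct.Closure.ReflexiveTransitive as Star using (Star; ε; _◅_; _◅◅_)

does⇒ : ∀ {P : Set} (d : Dec P) → does d ≡ true → P
does⇒ (yes p) _ = p

notDoes⇒¬ : ∀ {P : Set} (d : Dec P) → not (does d) ≡ true → ¬ P
notDoes⇒¬ (no ¬p) _ = ¬p

¬⇒notDoes : ∀ {P : Set} (d : Dec P) → ¬ P → not (does d) ≡ true
¬⇒notDoes d ¬p = cong not (dec-false d ¬p)

true≢false : true ≢ false
true≢false ()

≟-diag : ∀ {n} (a : Fin n) → does (a ≟ a) ≡ true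
≟-diag a = dec-true (a ≟ a) refl

∧-true : ∀ x {y} → x ∧ y ≡ true → x ≡ true × y ≡ true
∧-true true e = refl , e

∧-intro : ∀ {x y} → x ≡ true → y ≡ true → x ∧ y ≡ true
∧-intro refl e = e

darc-true : ∀ {n} (K : Subgraph n) {b c : Fin n} → darc (Dig K) b c ≡ true →
            edge K b b ≡ true × edge K c c ≡ true × b ≢ c × edge K b c ≡ true
darc-true K {b} {c} e =
  let (kb , e₁) = ∧-true (edge K b b) e
      (kc , e₂) = ∧-true (edge K c c) e₁
      (ne , kbc) = ∧-true (not (does (b ≟ c))) e₂
  in kb , kc , notDoes⇒¬ (b ≟ c) ne , kbc

darc-intro : ∀ {n} (K : Subgraph n) {b c : Fin n} → edge K b b ≡ true → edge K c c ≡ true →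
             b ≢ c → edge K b c ≡ true → darc (Dig K) b c ≡ true
darc-intro K {b} {c} kb kc ne kbc = ∧-intro kb (∧-intro kc (∧-intro (¬⇒notDoes (b ≟ c) ne) kbc))

-- An injection of Fin n into itself is onto (else it would inject Fin n into Fin (n - 1)).
injective⇒surjective : ∀ {n} (σ : Fin n → Fin n) → Injective _≡_ _≡_ σ → ∀ b → ∃ λ a → σ a ≡ b
injective⇒surjective {zero} σ inj ()
injective⇒surjective {suc m} σ inj b with any? (λ a → σ a ≟ b)
... | yes hit = hit
... | no miss = ⊥-elim (<-irrefl refl (injective⇒≤ {f = squeeze} squeeze-injective))
  where
    avoids : ∀ a → b ≢ σ a
    avoids a e = miss (a , sym e)
    squeeze : Fin (suc m) → Fin m
    squeeze a = punchOut (avoids a)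
    squeeze-injective : Injective _≡_ _≡_ squeeze
    squeeze-injective e = inj (punchOut-injective (avoids _) (avoids _) e)

module Orbit {n} {σ : Fin n → Fin n} (σ-injective : Injective _≡_ _≡_ σ) where

  iterate : ℕ → Fin n → Fin n
  iterate zero x = x
  iterate (suc k) x = σ (iterate k x)

  iterate-+ : ∀ a b x → iterate (a + b) x ≡ iterate a (iterate b x)
  iterate-+ zero b x = refl
  iterate-+ (suc a) b x = cong σ (iterate-+ a b x)

  iterate-injective : ∀ k {y z} → iterate k y ≡ iterate k z → y ≡ z
  iterate-injective zero e = e
  iterate-injective (suc k) e = iterate-injective k (σ-injective e)

  iterate-σ : ∀ k x → iterate k (σ x) ≡ σ (iterate k x)
  iterate-σ zero x = refl
  iterate-σ (suc k) x = cong σ (iterate-σ k x)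

  -- Among x, σ x, …, σⁿ x two points coincide, σᵖ x = σ^(p+d+1) x; cancelling σᵖ gives the period.
  period : ∀ x → ∃ λ d → iterate (suc d) x ≡ x
  period x with pigeonhole (n<1+n n) (λ (k : Fin (suc n)) → iterate (toℕ k) x)
  ... | p , q , p<q , same with m≤n⇒∃[o]m+o≡n p<q
  ... | d , p+1+d≡q = d , sym (iterate-injective (toℕ p) (begin
      iterate (toℕ p) x                 ≡⟨ same ⟩
      iterate (toℕ q) x                 ≡⟨ cong (λ m → iterate m x) (sym (trans (+-suc (toℕ p) d) p+1+d≡q)) ⟩
      iterate (toℕ p + suc d) x         ≡⟨ iterate-+ (toℕ p) (suc d) x ⟩
      iterate (toℕ p) (iterate (suc d) x) ∎))
    where open ≡-Reasoning

  module _ {T : Fin n → Fin n → Set} (moves : ∀ x → σ x ≡ x ⊎ T x (σ x)) where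

    walk : ∀ k x → Star T x (iterate k x)
    walk zero x = ε
    walk (suc k) x with moves (iterate k x)
    ... | inj₁ fixed = subst (Star T x) (sym fixed) (walk k x)
    ... | inj₂ step = walk k x ◅◅ (step ◅ ε)

    orbit-returns : ∀ x → Star T (σ x) x
    orbit-returns x with period x
    ... | d , e = subst (Star T (σ x)) (trans (iterate-σ d x) e) (walk d (σ x))

module Walks {n} (T : Fin n → Fin n → Set) where

  data Path : Fin n → Fin n → List (Fin n) → Set where
    stop : ∀ {x} → Path x x (x ∷ [])
    step : ∀ {x y z l} → T x y → Path y z l → Path x z (x ∷ l)

  private
    suffix : ∀ {x y z l} → Path y z l → x ∈ l → Unique l → ∃ λ l' → Path x z l' × Unique l'
    suffix stop (here refl) u = _ , stop , u
    suffix (step t p) (here refl) u = _ , step t p , u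
    suffix (step t p) (there m) (_ ∷ u) = suffix p m u

    ∉⇒distinct : ∀ {x : Fin n} l → ¬ x ∈ l → All (x ≢_) l
    ∉⇒distinct [] _ = []
    ∉⇒distinct (y ∷ l) x∉ = (λ e → x∉ (here e)) ∷ ∉⇒distinct l (λ m → x∉ (there m))

  simple : ∀ {x z} → Star T x z → ∃ λ l → Path x z l × Unique l
  simple ε = _ , stop , [] ∷ []
  simple {x} (t ◅ s) with simple s
  ... | l , p , u with member? _≟_ x l
  ... | yes x∈l = suffix p x∈l u
  ... | no x∉l = x ∷ l , step t p , ∉⇒distinct l x∉l ∷ u

  unique-length : ∀ {l : List (Fin n)} → Unique l → length l ≤ n
  unique-length {l} u = injective⇒≤ {f = lookup l} (lookup-injective u)
    where
      fresh : ∀ {x} {ys : List (Fin n)} → All (x ≢_) ys → ∀ k → x ≢ lookup ys k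
      fresh (p ∷ _) zero = p
      fresh (_ ∷ ps) (suc k) = fresh ps k
      lookup-injective : ∀ {l : List (Fin n)} → Unique l → Injective _≡_ _≡_ (lookup l)
      lookup-injective (_ ∷ _) {zero} {zero} _ = refl
      lookup-injective (x∉ ∷ _) {zero} {suc k} e = ⊥-elim (fresh x∉ k e)
      lookup-injective (x∉ ∷ _) {suc k} {zero} e = ⊥-elim (fresh x∉ k (sym e))
      lookup-injective (_ ∷ u) {suc j} {suc k} e = cong suc (lookup-injective u e)

  Within : ℕ → Fin n → Fin n → Set
  Within zero x y = x ≡ y
  Within (suc k) x y = x ≡ y ⊎ ∃ λ z → T x z × Within k z y

  within⇒star : ∀ k {x y} → Within k x y → Star T x y
  within⇒star zero refl = ε
  within⇒star (suc k) (inj₁ refl) = ε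
  within⇒star (suc k) (inj₂ (z , t , w)) = t ◅ within⇒star k w

  path⇒within : ∀ k {x y l} → Path x y l → length l ≤ suc k → Within k x y
  path⇒within zero stop _ = refl
  path⇒within (suc k) stop _ = inj₁ refl
  path⇒within zero (step t stop) (s≤s ())
  path⇒within zero (step t (step _ _)) (s≤s ())
  path⇒within (suc k) (step t p) (s≤s le) = inj₂ (_ , t , path⇒within k p le)

  module _ (T? : ∀ x y → Dec (T x y)) where

    within? : ∀ k x y → Dec (Within k x y)
    within? zero x y = x ≟ y
    within? (suc k) x y with x ≟ y
    ... | yes e = yes (inj₁ e)
    ... | no ne with any? (λ z → T? x z ×-dec within? k z y)
    ... | yes p = yes (inj₂ p)
    ... | no ¬p = no λ { (inj₁ e) → ne e ; (inj₂ p) → ¬p p }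

    -- Reachability is decidable: it suffices to look for simple walks, of length ≤ n.
    reachable? : ∀ x y → Dec (Star T x y)
    reachable? x y with within? n x y
    ... | yes w = yes (within⇒star n w)
    ... | no ¬w = no λ s → let (l , p , u) = simple s in
                    ¬w (path⇒within n p (m≤n⇒m≤1+n (unique-length u)))

-- Take a simple walk P from j to i; on the list i ∷ P, σ sends each entry
-- to the next one and fixes every point not on the cycle.
module CyclicShift {n} {T : Fin n → Fin n → Set} where
  open Walks T

  next : List (Fin n) → Fin n → Maybe (Fin n)
  next [] a = nothing
  next (x ∷ []) a = nothing
  next (x ∷ y ∷ r) a = if does (a ≟ x) then just y else next (y ∷ r) a

  next-head : ∀ x y r → next (x ∷ y ∷ r) x ≡ just y
  next-head x y r with x ≟ x
  ... | yes _ = refl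
  ... | no ne = ⊥-elim (ne refl)

  next-step : ∀ {x z l a c} → Path x z l → next l a ≡ just c → T a c
  next-step stop ()
  next-step {a = a} (step {x = x} {l = y ∷ r} t p) e with a ≟ x
  next-step (step t stop) refl | yes refl = t
  next-step (step t (step _ _)) refl | yes refl = t
  ... | no _ = next-step p e

  next-∈ : ∀ x r a {c} → next (x ∷ r) a ≡ just c → c ∈ r
  next-∈ x (y ∷ r) a e with a ≟ x
  next-∈ x (y ∷ r) a refl | yes _ = here refl
  ... | no _ = there (next-∈ y r a e)

  next-injective : ∀ x r → Unique r → ∀ {a b c} →
                   next (x ∷ r) a ≡ just c → next (x ∷ r) b ≡ just c → a ≡ b
  next-injective x (y ∷ r) (y∉r ∷ u) {a} {b} ea eb with a ≟ x | b ≟ x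
  ... | yes a≡x | yes b≡x = trans a≡x (sym b≡x)
  ... | yes _ | no _ = ⊥-elim (All.lookup y∉r (subst (_∈ r) (sym (just-injective ea)) (next-∈ y r b eb)) refl)
  ... | no _ | yes _ = ⊥-elim (All.lookup y∉r (subst (_∈ r) (sym (just-injective eb)) (next-∈ y r a ea)) refl)
  ... | no _ | no _ = next-injective y r u ea eb

  next-last : ∀ {x y z P b} → Path y z P → b ∈ (x ∷ P) → next (x ∷ P) b ≡ nothing → b ≡ z
  next-last {x} {b = b} stop m e with b ≟ x
  next-last stop (here b≡x) e | no ne = ⊥-elim (ne b≡x)
  next-last stop (there (here b≡z)) e | no _ = b≡z
  next-last {x} {b = b} (step t p) m e with b ≟ x
  next-last (step t p) (here b≡x) e | no ne = ⊥-elim (ne b≡x)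
  next-last (step t p) (there m) e | no _ = next-last p m e

  cycle⇒injection : ∀ {i j} → T i j → Star T j i →
    ∃ λ σ → Injective _≡_ _≡_ σ × σ i ≡ j × (∀ a → σ a ≡ a ⊎ T a (σ a))
  cycle⇒injection {i} {j} t r with simple r
  ... | P , p , u = σ , σ-injective , σi≡j , moves
    where
      σ : Fin n → Fin n
      σ a = fromMaybe a (next (i ∷ P) a)
      first : ∀ {P'} → Path j i P' → next (i ∷ P') i ≡ just j
      first stop = next-head i j []
      first (step {l = l} _ _) = next-head i j l
      σi≡j : σ i ≡ j
      σi≡j rewrite first p = refl
      moves : ∀ a → σ a ≡ a ⊎ T a (σ a)
      moves a with next (i ∷ P) a in e
      ... | just c = inj₂ (next-step (step t p) e)
      ... | nothing = inj₁ refl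
      -- every entry of P has a successor, since P ends at i, whose successor is j
      has-next : ∀ {b} → b ∈ P → next (i ∷ P) b ≢ nothing
      has-next m e with next-last p (there m) e
      ... | refl with trans (sym (first p)) e
      ... | ()
      σ-injective : Injective _≡_ _≡_ σ
      σ-injective {a} {b} eq with next (i ∷ P) a in ea | next (i ∷ P) b in eb
      ... | just c | just _ = next-injective i P u ea (subst (λ z → next (i ∷ P) b ≡ just z) (sym eq) eb)
      ... | just c | nothing = ⊥-elim (has-next (subst (_∈ P) eq (next-∈ i P a ea)) eb)
      ... | nothing | just c = ⊥-elim (has-next (subst (_∈ P) (sym eq) (next-∈ i P b eb)) ea)
      ... | nothing | nothing = eq

module Matchings {n} (G : BGraph n) (M-perfect : IsPM (full G) (Mmatch n)) where

  diagonal : ∀ a → G a a ≡ true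
  diagonal a = proj₁ M-perfect a a (≟-diag a)

  Arc : Fin n → Fin n → Set
  Arc a b = a ≢ b × G a b ≡ true

  arc? : ∀ a b → Dec (Arc a b)
  arc? a b = ¬? (a ≟ b) ×-dec (G a b Bool.≟ true)

  Reach : Fin n → Fin n → Set
  Reach = Star Arc

  reach? : ∀ a b → Dec (Reach a b)
  reach? = Walks.reachable? Arc arc?

  SameClass : Fin n → Fin n → Set
  SameClass a b = Reach a b × Reach b a

  sameClass? : ∀ a b → Dec (SameClass a b)
  sameClass? a b = reach? a b ×-dec reach? b a

  class-refl : ∀ a → SameClass a a
  class-refl a = ε , ε

  class-sym : ∀ {a b} → SameClass a b → SameClass b a
  class-sym (p , q) = q , p

  class-trans : ∀ {a b c} → SameClass a b → SameClass b c → SameClass a c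
  class-trans (p , q) (r , s) = p ◅◅ r , s ◅◅ q

  OnCycle : Fin n → Set
  OnCycle a = ∃ λ b → Arc a b × Reach b a

  onCycle? : ∀ a → Dec (OnCycle a)
  onCycle? a = any? (λ b → arc? a b ×-dec reach? b a)

  onCycle-class : ∀ {a b} → OnCycle a → SameClass a b → OnCycle b
  onCycle-class {a} {b} cyc (a⇝b , b⇝a) with b ≟ a | b⇝a
  ... | yes refl | _ = cyc
  ... | no b≢a | ε = ⊥-elim (b≢a refl)
  ... | no _ | t ◅ s = _ , t , s ◅◅ a⇝b

  ¬onCycle-class : ∀ {a b} → ¬ OnCycle a → SameClass a b → b ≡ a
  ¬onCycle-class {a} {b} ¬cyc (a⇝b , b⇝a) with b ≟ a | a⇝b
  ... | yes b≡a | _ = b≡a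
  ... | no b≢a | ε = ⊥-elim (b≢a refl)
  ... | no _ | t ◅ s = ⊥-elim (¬cyc (_ , t , s ◅◅ b⇝a))

  -- A perfect matching of G given as a function: u_a is matched to w_{σ a}.
  IsMatchingMap : (Fin n → Fin n) → Set
  IsMatchingMap σ = (∀ a → G a (σ a) ≡ true) × Injective _≡_ _≡_ σ

  graphOf : (Fin n → Fin n) → Fin n → Fin n → Bool
  graphOf σ a b = does (σ a ≟ b)

  matchingMap⇒pm : ∀ {σ} → IsMatchingMap σ → IsPM (full G) (graphOf σ)
  matchingMap⇒pm {σ} (σ-edges , σ-injective) = edges , rows , columns
    where
      edges : ∀ a b → graphOf σ a b ≡ true → G a b ≡ true
      edges a b e = subst (λ z → G a z ≡ true) (does⇒ (σ a ≟ b) e) (σ-edges a)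
      rows : ∀ a → true ≡ true → ExactlyOne (λ b → graphOf σ a b ≡ true)
      rows a _ = σ a , ≟-diag (σ a) , λ b e → sym (does⇒ (σ a ≟ b) e)
      columns : ∀ b → true ≡ true → ExactlyOne (λ a → graphOf σ a b ≡ true)
      columns b _ with injective⇒surjective σ σ-injective b
      ... | a , refl = a , ≟-diag (σ a) , λ a' e → σ-injective (does⇒ (σ a' ≟ σ a) e)

  pm⇒matchingMap : ∀ {N} → IsPM (full G) N →
    ∃ λ σ → IsMatchingMap σ × (∀ a → N a (σ a) ≡ true) × (∀ a b → N a b ≡ true → σ a ≡ b)
  pm⇒matchingMap {N} (edges , rows , columns) = σ , (σ-edges , σ-injective) , σ-in-N , σ-unique
    where
      σ : Fin n → Fin n
      σ a = proj₁ (rows a refl)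
      σ-in-N : ∀ a → N a (σ a) ≡ true
      σ-in-N a = proj₁ (proj₂ (rows a refl))
      σ-unique : ∀ a b → N a b ≡ true → σ a ≡ b
      σ-unique a b e = sym (proj₂ (proj₂ (rows a refl)) b e)
      σ-edges : ∀ a → G a (σ a) ≡ true
      σ-edges a = edges a (σ a) (σ-in-N a)
      σ-injective : Injective _≡_ _≡_ σ
      σ-injective {a} {b} e =
        let (_ , _ , unique) = columns (σ a) refl in
        trans (unique a (σ-in-N a)) (sym (unique b (subst (λ z → N b z ≡ true) (sym e) (σ-in-N b))))

  matchingMap-moves : ∀ {σ} → IsMatchingMap σ → ∀ x → σ x ≡ x ⊎ Arc x (σ x)
  matchingMap-moves {σ} (σ-edges , _) x with σ x ≟ x
  ... | yes e = inj₁ e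
  ... | no ne = inj₂ ((λ e → ne (sym e)) , σ-edges x)

  -- If a perfect matching uses u_i w_j, then v_j reaches v_i in D (follow the orbit of j).
  matched⇒reach : ∀ {N i j} → IsPM (full G) N → N i j ≡ true → Reach j i
  matched⇒reach pm Nij with pm⇒matchingMap pm
  ... | σ , mm , _ , σ-unique =
    subst (λ z → Reach z _) (σ-unique _ _ Nij) (Orbit.orbit-returns (proj₂ mm) (matchingMap-moves mm) _)

  cycle⇒matchingMap : ∀ {i j} → Arc i j → Reach j i → ∃ λ σ → IsMatchingMap σ × σ i ≡ j
  cycle⇒matchingMap t r with CyclicShift.cycle⇒injection t r
  ... | σ , σ-injective , σi≡j , moves = σ , (σ-edges , σ-injective) , σi≡j
    where
      σ-edges : ∀ a → G a (σ a) ≡ true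
      σ-edges a with moves a
      ... | inj₁ fixed = subst (λ z → G a z ≡ true) (sym fixed) (diagonal a)
      ... | inj₂ arc = proj₂ arc

  graphOf-uses : ∀ σ {a b} → σ a ≡ b → graphOf σ a b ≡ true
  graphOf-uses σ {a} refl = ≟-diag (σ a)

  used⇒¬fixedSingle : ∀ {N b c} → IsPM (full G) N → N b c ≡ true → ¬ FixedSingle G b c
  used⇒¬fixedSingle pm used (_ , single) = true≢false (trans (sym used) (single _ pm))

  avoided⇒¬fixedDouble : ∀ {N b c} → IsPM (full G) N → N b c ≢ true → ¬ FixedDouble G b c
  avoided⇒¬fixedDouble pm avoided (_ , double) = avoided (double _ pm)

  -- An arc b → c on a cycle of D is a non-fixed edge of G: the matching along the cycle
  -- uses it, and M avoids it.
  cycleArc-nonFixed : ∀ {b c} → Arc b c → Reach c b → NonFixed G b c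
  cycleArc-nonFixed {b} {c} t@(b≢c , g) r with cycle⇒matchingMap t r
  ... | σ , mm , σb≡c = g ,
    [ used⇒¬fixedSingle (matchingMap⇒pm mm) (graphOf-uses σ σb≡c)
    , avoided⇒¬fixedDouble M-perfect (λ e → b≢c (does⇒ (b ≟ c) e)) ]

  -- For v_a on a cycle, u_a w_a is non-fixed: M uses it, the matching along the cycle avoids it.
  onCycle-nonFixed : ∀ {a} → OnCycle a → NonFixed G a a
  onCycle-nonFixed {a} (b , t@(a≢b , _) , r) with cycle⇒matchingMap t r
  ... | σ , mm , σa≡b = diagonal a ,
    [ used⇒¬fixedSingle M-perfect (≟-diag a)
    , avoided⇒¬fixedDouble (matchingMap⇒pm mm) (λ e → a≢b (trans (sym (does⇒ (σ a ≟ a) e)) σa≡b)) ]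

  -- Conversely v_c reaches v_b for a non-fixed edge u_b w_c: otherwise no matching uses it.
  nonFixed⇒reach : ∀ {b c} → NonFixed G b c → Reach c b
  nonFixed⇒reach {b} {c} (g , ¬fixed) with reach? c b
  ... | yes r = r
  ... | no ¬r = ⊥-elim (¬fixed (inj₁ (g , unused)))
    where
      unused : ∀ N → IsPM (full G) N → N b c ≡ false
      unused N pm with N b c in e
      ... | true = ⊥-elim (¬r (matched⇒reach pm e))
      ... | false = refl

  ¬onCycle⇒fixedDouble : ∀ {a} → ¬ OnCycle a → FixedDouble G a a
  ¬onCycle⇒fixedDouble {a} ¬cyc = diagonal a , used
    where
      used : ∀ N → IsPM (full G) N → N a a ≡ true
      used N pm@(edges , rows , _) with rows a refl
      ... | b , Nab , _ with b ≟ a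
      ... | yes refl = Nab
      ... | no b≢a = ⊥-elim (¬cyc (b , ((λ e → b≢a (sym e)) , edges a b Nab) , matched⇒reach pm Nab))

  nonFixedLoop⇒onCycle : ∀ {a} → NonFixed G a a → OnCycle a
  nonFixedLoop⇒onCycle {a} (_ , ¬fixed) with onCycle? a
  ... | yes cyc = cyc
  ... | no ¬cyc = ⊥-elim (¬fixed (inj₂ (¬onCycle⇒fixedDouble ¬cyc)))

  nonFixed⇒sameClass : ∀ {b c} → NonFixed G b c → SameClass b c
  nonFixed⇒sameClass {b} {c} nf with b ≟ c
  ... | yes refl = class-refl b
  ... | no b≢c = ((b≢c , proj₁ nf) ◅ ε) , nonFixed⇒reach nf

  index : Vtx n → Fin n
  index (inj₁ a) = a
  index (inj₂ a) = a

  H-vertex⇒onCycle : ∀ x → pvert (Hgraph G) x → OnCycle (index x)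
  H-vertex⇒onCycle (inj₁ a) (c , nf) with a ≟ c
  ... | yes refl = nonFixedLoop⇒onCycle nf
  ... | no a≢c = c , (a≢c , proj₁ nf) , nonFixed⇒reach nf
  H-vertex⇒onCycle (inj₂ a) (b , nf) = onCycle-class (H-vertex⇒onCycle (inj₁ b) (a , nf)) (nonFixed⇒sameClass nf)

  nonFixedWalk⇒sameClass : ∀ (K : Subgraph n) → (∀ b c → edge K b c ≡ true → NonFixed G b c) →
    ∀ {x y} → Star (Adj K) x y → SameClass (index x) (index y)
  nonFixedWalk⇒sameClass K nf ε = class-refl _
  nonFixedWalk⇒sameClass K nf {inj₁ b} (_◅_ {j = inj₂ c} e s) =
    class-trans (nonFixed⇒sameClass (nf b c e)) (nonFixedWalk⇒sameClass K nf s)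
  nonFixedWalk⇒sameClass K nf {inj₂ c} (_◅_ {j = inj₁ b} e s) =
    class-trans (class-sym (nonFixed⇒sameClass (nf b c e))) (nonFixedWalk⇒sameClass K nf s)
  nonFixedWalk⇒sameClass K nf {inj₁ _} (_◅_ {j = inj₁ _} () s)
  nonFixedWalk⇒sameClass K nf {inj₂ _} (_◅_ {j = inj₂ _} () s)

module ClassGraphs {n} (G : BGraph n) (M-perfect : IsPM (full G) (Mmatch n)) where
  open Matchings G M-perfect
  open Equivalence using (to; from)

  IsClassGraph : Subgraph n → Fin n → Set
  IsClassGraph K a =
    (∀ x → (vert K x ≡ true) ⇔ SameClass a (index x)) ×
    (∀ b c → (edge K b c ≡ true) ⇔ (SameClass a b × SameClass a c × G b c ≡ true))

  classGraph : Fin n → Subgraph n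
  classGraph a = record
    { vert = λ x → does (sameClass? a (index x))
    ; edge = λ b c → does (sameClass? a b) ∧ does (sameClass? a c) ∧ G b c }

  classGraph-isClassGraph : ∀ a → IsClassGraph (classGraph a) a
  classGraph-isClassGraph a = (λ x → mk⇔ (does⇒ (sameClass? a (index x))) (dec-true (sameClass? a (index x))))
                            , λ b c → mk⇔ (split b c) (λ (ab , ac , g) → ∧-intro (dec-true (sameClass? a b) ab)
                                                          (∧-intro (dec-true (sameClass? a c) ac) g))
    where
      split : ∀ b c → edge (classGraph a) b c ≡ true → SameClass a b × SameClass a c × G b c ≡ true
      split b c e = let (ab , e₁) = ∧-true (does (sameClass? a b)) e
                        (ac , g) = ∧-true (does (sameClass? a c)) e₁
                    in does⇒ (sameClass? a b) ab , does⇒ (sameClass? a c) ac , g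

  darcD⇒arc : ∀ {b c} → darc (Dig (full G)) b c ≡ true → Arc b c
  darcD⇒arc e = let (_ , _ , ne , g) = darc-true (full G) e in ne , g

  module ClassGraph (K : Subgraph n) (a : Fin n) (isCG : IsClassGraph K a) where

    vertex-inClass : ∀ {x} → vert K x ≡ true → SameClass a (index x)
    vertex-inClass {x} = to (proj₁ isCG x)

    inClass-vertex : ∀ {x} → SameClass a (index x) → vert K x ≡ true
    inClass-vertex {x} = from (proj₁ isCG x)

    edge-inClass : ∀ {b c} → edge K b c ≡ true → SameClass a b × SameClass a c × G b c ≡ true
    edge-inClass {b} {c} = to (proj₂ isCG b c)

    inClass-edge : ∀ {b c} → SameClass a b → SameClass a c → G b c ≡ true → edge K b c ≡ true
    inClass-edge {b} {c} ab ac g = from (proj₂ isCG b c) (ab , ac , g)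

    loop : ∀ {b} → SameClass a b → edge K b b ≡ true
    loop {b} ab = inClass-edge ab ab (diagonal b)

    -- An arc of D inside the class of v_a; such arcs are exactly the arcs of D(K).
    ClassArc : Fin n → Fin n → Set
    ClassArc u v = Arc u v × SameClass a u × SameClass a v

    classArc⇒darc : ∀ {u v} → ClassArc u v → darc (Dig K) u v ≡ true
    classArc⇒darc ((ne , g) , au , av) = darc-intro K (loop au) (loop av) ne (inClass-edge au av g)

    classWalk : ∀ {y z} → SameClass a y → SameClass a z → Reach y z → Star ClassArc y z
    classWalk ay az ε = ε
    classWalk ay az (t ◅ s) =
      let ay' = (proj₁ ay ◅◅ (t ◅ ε)) , (s ◅◅ proj₂ az) in
      (t , ay , ay') ◅ classWalk ay' az s

    dig-sub : Dig K ≼ Dig (full G)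
    dig-sub = (λ b _ → diagonal b) , λ b c e →
      let (kb , kc , ne , kbc) = darc-true K e in
      darc-intro (full G) (diagonal b) (diagonal c) ne (proj₂ (proj₂ (edge-inClass kbc))) , kb , kc

    dig-strong : Strong (Dig K)
    dig-strong = (a , loop (class-refl a)) , λ y z ky kz →
      let ay = proj₁ (edge-inClass ky) ; az = proj₁ (edge-inClass kz) in
      Star.map classArc⇒darc (classWalk ay az (proj₂ ay ◅◅ proj₁ az))

    dig-maximal : ∀ D' → D' ≼ Dig (full G) → Strong D' → Dig K ≼ D' → D' ≼ Dig K
    dig-maximal D' (_ , arcs) (_ , strong) (verts , _) = inD-K , arcsD-K
      where
        toReach : ∀ {u v} → Star (λ p q → darc D' p q ≡ true) u v → Reach u v
        toReach = Star.map (λ e → darcD⇒arc (proj₁ (arcs _ _ e)))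
        a∈D' : dvert D' a ≡ true
        a∈D' = verts a (loop (class-refl a))
        inClass : ∀ {y} → dvert D' y ≡ true → SameClass a y
        inClass y∈D' = toReach (strong _ _ a∈D' y∈D') , toReach (strong _ _ y∈D' a∈D')
        inD-K : ∀ b → dvert D' b ≡ true → dvert (Dig K) b ≡ true
        inD-K b b∈D' = loop (inClass b∈D')
        arcsD-K : ∀ b c → darc D' b c ≡ true →
                  darc (Dig K) b c ≡ true × dvert D' b ≡ true × dvert D' c ≡ true
        arcsD-K b c e = let (eD , b∈D' , c∈D') = arcs b c e in
          classArc⇒darc (darcD⇒arc eD , inClass b∈D' , inClass c∈D') , b∈D' , c∈D'

    strongComponent : IsStrongComponent (Dig (full G)) (Dig K)
    strongComponent = dig-sub , dig-strong , dig-maximal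

    -- Going u_b → w_c → u_c along an arc b → c, a class walk of D gives a walk of K.
    classWalk⇒walk : ∀ {b c} → Star ClassArc b c → Star (Adj K) (inj₁ b) (inj₁ c)
    classWalk⇒walk ε = ε
    classWalk⇒walk (_◅_ {j = c} ((_ , g) , ab , ac) s) =
      _◅_ {j = inj₂ c} (inClass-edge ab ac g) (_◅_ {j = inj₁ c} (loop ac) (classWalk⇒walk s))

    toU : ∀ x → vert K x ≡ true → Star (Adj K) x (inj₁ (index x))
    toU (inj₁ b) _ = ε
    toU (inj₂ b) v = loop (vertex-inClass v) ◅ ε

    fromU : ∀ x → vert K x ≡ true → Star (Adj K) (inj₁ (index x)) x
    fromU (inj₁ b) _ = ε
    fromU (inj₂ b) v = loop (vertex-inClass v) ◅ ε

    connected : Connected K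
    connected = (inj₁ a , inClass-vertex (class-refl a)) , λ x y vx vy →
      let ax = vertex-inClass vx ; ay = vertex-inClass vy in
      toU x vx ◅◅ classWalk⇒walk (classWalk ax ay (proj₂ ax ◅◅ proj₁ ay)) ◅◅ fromU y vy

    H-maximal : ∀ K' → K' ⊑ Hgraph G → Connected K' → K ≤G K' → K' ≤G K
    H-maximal K' (_ , edges) (_ , conn) (verts , _) = verts-K , edges-K
      where
        a∈K' : vert K' (inj₁ a) ≡ true
        a∈K' = verts (inj₁ a) (inClass-vertex (class-refl a))
        inClass : ∀ {x} → vert K' x ≡ true → SameClass a (index x)
        inClass x∈K' = nonFixedWalk⇒sameClass K' (λ b c e → proj₁ (edges b c e)) (conn _ _ a∈K' x∈K')
        verts-K : ∀ x → vert K' x ≡ true → vert K x ≡ true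
        verts-K x x∈K' = inClass-vertex (inClass x∈K')
        edges-K : ∀ b c → edge K' b c ≡ true → edge K b c ≡ true
        edges-K b c e = let (nf , b∈K' , c∈K') = edges b c e in
          inClass-edge (inClass b∈K') (inClass c∈K') (proj₁ nf)

    elementaryComponent : OnCycle a → IsElementaryComponent G K
    elementaryComponent cyc = (vertices-H , λ b c e → edges-H b c e , ends e) , connected , H-maximal
      where
        edges-H : ∀ b c → edge K b c ≡ true → NonFixed G b c
        edges-H b c e with edge-inClass e | b ≟ c
        ... | ab , ac , g | yes refl = onCycle-nonFixed (onCycle-class cyc ab)
        ... | ab , ac , g | no b≢c = cycleArc-nonFixed (b≢c , g) (proj₂ ac ◅◅ proj₁ ab)
        ends : ∀ {b c} → edge K b c ≡ true → vert K (inj₁ b) ≡ true × vert K (inj₂ c) ≡ true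
        ends e = let (ab , ac , _) = edge-inClass e in inClass-vertex ab , inClass-vertex ac
        vertices-H : ∀ x → vert K x ≡ true → pvert (Hgraph G) x
        vertices-H (inj₁ b) v = b , onCycle-nonFixed (onCycle-class cyc (vertex-inClass v))
        vertices-H (inj₂ b) v = b , onCycle-nonFixed (onCycle-class cyc (vertex-inClass v))

    fixedDoubleEdge : ¬ OnCycle a → IsSingleFixedDoubleEdge G K
    fixedDoubleEdge ¬cyc = a , a , ¬onCycle⇒fixedDouble ¬cyc , vertices , edges
      where
        only : ∀ {b} → SameClass a b → b ≡ a
        only ab = ¬onCycle-class ¬cyc ab
        vertices : ∀ x → (vert K x ≡ true → (x ≡ inj₁ a ⊎ x ≡ inj₂ a)) ×
                         ((x ≡ inj₁ a ⊎ x ≡ inj₂ a) → vert K x ≡ true)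
        vertices (inj₁ b) = (λ v → inj₁ (cong inj₁ (only (vertex-inClass v))))
                          , λ { (inj₁ refl) → inClass-vertex (class-refl a) ; (inj₂ ()) }
        vertices (inj₂ b) = (λ v → inj₂ (cong inj₂ (only (vertex-inClass v))))
                          , λ { (inj₁ ()) ; (inj₂ refl) → inClass-vertex (class-refl a) }
        edges : ∀ b c → (edge K b c ≡ true → (b ≡ a × c ≡ a)) × ((b ≡ a × c ≡ a) → edge K b c ≡ true)
        edges b c = (λ e → let (ab , ac , _) = edge-inClass e in only ab , only ac)
                  , λ { (refl , refl) → loop (class-refl a) }

module Recognition {n} (G : BGraph n) (M-perfect : IsPM (full G) (Mmatch n))
                   (G₁ : Subgraph n) (G₁⊑G : G₁ ⊑ toP (full G)) (G₁-perfect : IsPM G₁ (M∩ G₁)) where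
  open Matchings G M-perfect
  open ClassGraphs G M-perfect

  M∩-true : ∀ {b c} → M∩ G₁ b c ≡ true → b ≡ c × edge G₁ b c ≡ true
  M∩-true {b} {c} e with b ≟ c
  ... | yes b≡c = b≡c , e

  -- Since E(G₁) ∩ M is a perfect matching of G₁, u_b (or w_b) is a vertex of G₁ iff u_b w_b ∈ E(G₁).
  vertex⇒loop : ∀ {x} → vert G₁ x ≡ true → edge G₁ (index x) (index x) ≡ true
  vertex⇒loop {inj₁ b} v = let (c , m , _) = proj₁ (proj₂ G₁-perfect) b v ; (b≡c , e) = M∩-true m in
    subst (λ z → edge G₁ b z ≡ true) (sym b≡c) e
  vertex⇒loop {inj₂ c} v = let (b , m , _) = proj₂ (proj₂ G₁-perfect) c v ; (b≡c , e) = M∩-true m in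
    subst (λ z → edge G₁ z c ≡ true) b≡c e

  loop⇒vertex : ∀ x → edge G₁ (index x) (index x) ≡ true → vert G₁ x ≡ true
  loop⇒vertex (inj₁ b) e = proj₁ (proj₂ (proj₂ G₁⊑G b b e))
  loop⇒vertex (inj₂ b) e = proj₂ (proj₂ (proj₂ G₁⊑G b b e))

  edge⇒loops : ∀ {b c} → edge G₁ b c ≡ true → edge G₁ b b ≡ true × edge G₁ c c ≡ true × G b c ≡ true
  edge⇒loops {b} {c} e = let (g , vb , vc) = proj₂ G₁⊑G b c e in
    vertex⇒loop {inj₁ b} vb , vertex⇒loop {inj₂ c} vc , g

  classGraph-criterion : ∀ a →
    (∀ {b} → edge G₁ b b ≡ true → SameClass a b) →
    (∀ {b} → SameClass a b → edge G₁ b b ≡ true) →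
    (∀ {b c} → b ≢ c → SameClass a b → SameClass a c → G b c ≡ true → edge G₁ b c ≡ true) →
    IsClassGraph G₁ a
  classGraph-criterion a loop⇒class class⇒loop class⇒edge =
      (λ x → mk⇔ (λ v → loop⇒class (vertex⇒loop v)) (λ ax → loop⇒vertex x (class⇒loop ax)))
    , λ b c → mk⇔ (λ e → let (lb , lc , g) = edge⇒loops e in loop⇒class lb , loop⇒class lc , g)
                  (λ (ab , ac , g) → class⇒edge′ ab ac g)
    where
      class⇒edge′ : ∀ {b c} → SameClass a b → SameClass a c → G b c ≡ true → edge G₁ b c ≡ true
      class⇒edge′ {b} {c} ab ac g with b ≟ c
      ... | yes refl = class⇒loop ab
      ... | no b≢c = class⇒edge b≢c ab ac g

  strong⇒classGraph : IsStrongComponent (Dig (full G)) (Dig G₁) → ∃ (IsClassGraph G₁)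
  strong⇒classGraph (_ , ((a , a∈D₁) , strong) , maximal) =
    a , classGraph-criterion a loop⇒class class⇒loop class⇒edge
    where
      open ClassGraph (classGraph a) a (classGraph-isClassGraph a)
      arc₁⇒arc : ∀ {u v} → darc (Dig G₁) u v ≡ true → Arc u v
      arc₁⇒arc e = let (_ , _ , ne , e₁) = darc-true G₁ e in ne , proj₂ (proj₂ (edge⇒loops e₁))
      loop⇒class : ∀ {b} → edge G₁ b b ≡ true → SameClass a b
      loop⇒class b∈D₁ = Star.map arc₁⇒arc (strong _ _ a∈D₁ b∈D₁)
                      , Star.map arc₁⇒arc (strong _ _ b∈D₁ a∈D₁)
      D₁≼class : Dig G₁ ≼ Dig (classGraph a)
      D₁≼class = (λ b b∈D₁ → loop (loop⇒class b∈D₁)) , λ b c e →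
        let (lb , lc , _ , _) = darc-true G₁ e in
        classArc⇒darc (arc₁⇒arc e , loop⇒class lb , loop⇒class lc) , lb , lc
      class≼D₁ : Dig (classGraph a) ≼ Dig G₁
      class≼D₁ = maximal (Dig (classGraph a)) dig-sub dig-strong D₁≼class
      class⇒loop : ∀ {b} → SameClass a b → edge G₁ b b ≡ true
      class⇒loop ab = proj₁ class≼D₁ _ (loop ab)
      class⇒edge : ∀ {b c} → b ≢ c → SameClass a b → SameClass a c → G b c ≡ true → edge G₁ b c ≡ true
      class⇒edge b≢c ab ac g =
        let arc₁ = proj₁ (proj₂ class≼D₁ _ _ (classArc⇒darc ((b≢c , g) , ab , ac)))
        in proj₂ (proj₂ (proj₂ (darc-true G₁ arc₁)))

  elementary⇒classGraph : IsElementaryComponent G G₁ → ∃ (IsClassGraph G₁)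
  elementary⇒classGraph ((inH , edgesH) , ((x , x∈G₁) , conn) , maximal) =
    a , classGraph-criterion a loop⇒class class⇒loop (λ _ → class⇒edge)
    where
      a = index x
      open ClassGraph (classGraph a) a (classGraph-isClassGraph a)
      loop⇒class : ∀ {b} → edge G₁ b b ≡ true → SameClass a b
      loop⇒class {b} lb = nonFixedWalk⇒sameClass G₁ (λ b c e → proj₁ (edgesH b c e))
                            (conn x (inj₁ b) x∈G₁ (loop⇒vertex (inj₁ b) lb))
      G₁≤class : G₁ ≤G classGraph a
      G₁≤class = (λ y v → inClass-vertex {y} (loop⇒class (vertex⇒loop v)))
               , λ b c e → let (lb , lc , g) = edge⇒loops e in inClass-edge (loop⇒class lb) (loop⇒class lc) g
      class≤G₁ : classGraph a ≤G G₁
      class≤G₁ = let (classH , classConn , _) = elementaryComponent (H-vertex⇒onCycle x (inH x x∈G₁)) in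
        maximal (classGraph a) classH classConn G₁≤class
      class⇒loop : ∀ {b} → SameClass a b → edge G₁ b b ≡ true
      class⇒loop {b} ab = vertex⇒loop {inj₁ b} (proj₁ class≤G₁ (inj₁ b) (inClass-vertex {inj₁ b} ab))
      class⇒edge : ∀ {b c} → SameClass a b → SameClass a c → G b c ≡ true → edge G₁ b c ≡ true
      class⇒edge {b} {c} ab ac g = proj₂ class≤G₁ b c (inClass-edge ab ac g)

  fixedDouble⇒classGraph : IsSingleFixedDoubleEdge G G₁ → ∃ (IsClassGraph G₁)
  fixedDouble⇒classGraph (i , j , fd , vertices , edges) with does⇒ (i ≟ j) (proj₂ fd (Mmatch n) M-perfect)
  ... | refl = i , classGraph-criterion i loop⇒class class⇒loop class⇒edge
    where
      -- u_i w_i is fixed double, so v_i lies on no cycle and its class is {v_i}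
      ¬cyc : ¬ OnCycle i
      ¬cyc cyc = proj₂ (onCycle-nonFixed cyc) (inj₂ fd)
      loop⇒class : ∀ {b} → edge G₁ b b ≡ true → SameClass i b
      loop⇒class {b} lb with proj₁ (vertices (inj₁ b)) (loop⇒vertex (inj₁ b) lb)
      ... | inj₁ refl = class-refl i
      class⇒loop : ∀ {b} → SameClass i b → edge G₁ b b ≡ true
      class⇒loop ib with ¬onCycle-class ¬cyc ib
      ... | refl = proj₂ (edges i i) (refl , refl)
      class⇒edge : ∀ {b c} → b ≢ c → SameClass i b → SameClass i c → G b c ≡ true → edge G₁ b c ≡ true
      class⇒edge b≢c ib ic _ = ⊥-elim (b≢c (trans (¬onCycle-class ¬cyc ib) (sym (¬onCycle-class ¬cyc ic))))

theorem21 : ∀ {n} (G : BGraph n) → IsPM (full G) (Mmatch n) →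
    (G₁ : Subgraph n) → G₁ ⊑ toP (full G) → IsPM G₁ (M∩ G₁) →
    ((IsElementaryComponent G G₁ ⊎ IsSingleFixedDoubleEdge G G₁) ⇔
     IsStrongComponent (Dig (full G)) (Dig G₁))
theorem21 G M-perfect G₁ G₁⊑G G₁-perfect = mk⇔ component⇒strong strong⇒component
  where
    open Matchings G M-perfect
    open ClassGraphs G M-perfect
    open Recognition G M-perfect G₁ G₁⊑G G₁-perfect

    component⇒strong : IsElementaryComponent G G₁ ⊎ IsSingleFixedDoubleEdge G G₁ →
                       IsStrongComponent (Dig (full G)) (Dig G₁)
    component⇒strong (inj₁ elem) = let (a , cg) = elementary⇒classGraph elem in ClassGraph.strongComponent G₁ a cg
    component⇒strong (inj₂ fd) = let (a , cg) = fixedDouble⇒classGraph fd in ClassGraph.strongComponent G₁ a cg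

    strong⇒component : IsStrongComponent (Dig (full G)) (Dig G₁) →
                       IsElementaryComponent G G₁ ⊎ IsSingleFixedDoubleEdge G G₁
    strong⇒component sc with strong⇒classGraph sc
    ... | a , cg with onCycle? a
    ... | yes cyc = inj₁ (ClassGraph.elementaryComponent G₁ a cg cyc)
    ... | no ¬cyc = inj₂ (ClassGraph.fixedDoubleEdge G₁ a cg ¬cyc)
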